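{- Let $\sigma\in\mathfrak{S}_n$ have rix-factorization $\sigma=\alpha_1\alpha_2\cdots\alpha_i\beta$, and let $x_k$ be the last letter of $\alpha_k$ for $1\le k\le i$. Then (i) $x_1>x_2>\cdots>x_i>\beta_1(\sigma)$; (ii) $\mathrm{rix}(\sigma)=0$ if and only if $\beta$ is an F-hook; (iii) $\mathrm{rix}(\sigma)=|\mathrm{RIX}(\sigma)|$.
   Context: Words have distinct letters from $[n]$. A letter $w_i$ of $w=w_1\cdots w_k$ is a descent top if $w_i>w_{i+1}$. A word of length 1 is an L-hook; a word of length $\ge2$ is an L-hook (resp. F-hook) if its last (resp. first) letter is its greatest letter. The rix-factorization of $\sigma\in\mathfrak{S}_n$ is $\sigma=\alpha_1\cdots\alpha_i\beta$ obtained by the algorithm: (1) $w\leftarrow\sigma$, $i\leftarrow0$; (2) if $w$ is increasing, set $\beta=w$ and stop; otherwise $i\leftarrow i+1$, let $x$ be the greatest descent top of $w$ and write $w=w'xw''$; (3) if $w'$ is empty, set $\beta=w$ and stop; otherwise set $\alpha_i=w'x$, $w\leftarrow w''$, and go to (2). (So each $\alpha_j$ is an L-hook of length $\ge2$ and $\beta$ is an L-hook or F-hook.) $\beta_1(\sigma)$ is the first letter of $\beta$; $\mathrm{RIX}(\sigma)$ is the set of letters in the maximal increasing suffix of $\beta$ that are $\ge\beta_1(\sigma)$. The statistic $\mathrm{rix}$ on words is defined recursively: $\mathrm{rix}(\emptyset)=0$; if $w=w_1\cdots w_k$ and $w_i=\max\{w_1,\dots,w_k\}$, then $\mathrm{rix}(w)=0$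 if $i=1<k$; $\mathrm{rix}(w)=1+\mathrm{rix}(w_1\cdots w_{k-1})$ if $i=k$; $\mathrm{rix}(w)=\mathrm{rix}(w_{i+1}\cdots w_k)$ if $1<i<k$. -}

module Defs where

open import Data.Nat using (ℕ; zero; suc; _+_; _<_; _≤_; _>_; _<ᵇ_; _≡ᵇ_; _≤ᵇ_; _⊔_)
open import Data.Bool using (Bool; true; false; if_then_else_)
open import Data.List using (List; []; _∷_; _++_; length; reverse; filterᵇ; map; upTo)
open import Data.List.Relation.Unary.All using (All)
open import Data.List.Relation.Unary.Linked using (Linked)
open import Data.List.Relation.Binary.Permutation.Propositional using (_↭_)
open import Data.Product using (_×_; _,_; ∃; proj₁; proj₂)
open import Relation.Binary.PropositionalEquality using (_≡_)

-- A permutation of [n] = {1,…,n}, in one-line notation, as a list of naturals.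
IsPerm : ℕ → List ℕ → Set
IsPerm n σ = σ ↭ map suc (upTo n)

-- greatest letter of a word (0 for the empty word; letters are ≥ 1)
maxList : List ℕ → ℕ
maxList []      = 0
maxList (a ∷ w) = a ⊔ maxList w

descentTops : List ℕ → List ℕ
descentTops []            = []
descentTops (a ∷ [])      = []
descentTops (a ∷ b ∷ w)   =
  if b <ᵇ a then a ∷ descentTops (b ∷ w) else descentTops (b ∷ w)

-- splitOn x w = (w' , w'') where w = w' x w'' (first occurrence of x);
-- if x does not occur, (w , []).
splitOn : ℕ → List ℕ → List ℕ × List ℕ
splitOn x []      = [] , []
splitOn x (a ∷ w) with a ≡ᵇ x
... | true  = [] , w
... | false = (a ∷ proj₁ (splitOn x w)) , proj₂ (splitOn x w)

-- one round of the rix-factorization algorithm, with fuel (fuel = length w suffices,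
-- since each recursive call is on a strictly shorter word).
rixFactAux : ℕ → List ℕ → List (List ℕ) × List ℕ
rixFactAux zero w = [] , w
rixFactAux (suc fuel) w with descentTops w
... | []    = [] , w                                   -- w increasing: β = w
... | d ∷ ds with splitOn (maxList (d ∷ ds)) w
...   | [] , w''       = [] , w
...   | (a ∷ w') , w'' =
  let x = maxList (d ∷ ds) ; r = rixFactAux fuel w''
  in ((a ∷ w') ++ (x ∷ [])) ∷ proj₁ r , proj₂ r

-- rix-factorization σ = α₁ ⋯ αᵢ β : returns ([α₁, …, αᵢ] , β)
rixFact : List ℕ → List (List ℕ) × List ℕ
rixFact σ = rixFactAux (length σ) σ

-- last letter of a word (0 on the empty word; never used there)
lastLetter : List ℕ → ℕ
lastLetter []          = 0
lastLetter (a ∷ [])    = a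
lastLetter (a ∷ b ∷ w) = lastLetter (b ∷ w)

firstLetter : List ℕ → ℕ
firstLetter []      = 0
firstLetter (a ∷ _) = a

beta1 : List ℕ → ℕ
beta1 σ = firstLetter (proj₂ (rixFact σ))

IsFHook : List ℕ → Set
IsFHook w = ∃ λ a → ∃ λ b → ∃ λ rest → (w ≡ a ∷ b ∷ rest) × All (_≤ a) (b ∷ rest)

decPrefix : List ℕ → List ℕ
decPrefix []          = []
decPrefix (a ∷ [])    = a ∷ []
decPrefix (a ∷ b ∷ r) = if b <ᵇ a then a ∷ decPrefix (b ∷ r) else a ∷ []

incSuffix : List ℕ → List ℕ
incSuffix w = reverse (decPrefix (reverse w))

RIX : List ℕ → List ℕ
RIX σ = filterᵇ (λ y → beta1 σ ≤ᵇ y) (incSuffix (proj₂ (rixFact σ)))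

rixAux : ℕ → List ℕ → ℕ
rixAux zero w = 0
rixAux (suc fuel) [] = 0
rixAux (suc fuel) (a ∷ w) with splitOn (maxList (a ∷ w)) (a ∷ w)
... | [] , []           = 1 + rixAux fuel []          -- i = k = 1
... | [] , (c ∷ post)   = 0                           -- i = 1 < k
... | (p ∷ pre) , []    = 1 + rixAux fuel (p ∷ pre)   -- i = k: rix of w₁⋯w_{k-1}
... | (p ∷ pre) , (c ∷ post) = rixAux fuel (c ∷ post) -- 1 < i < k

rix : List ℕ → ℕ
rix w = rixAux (length w) w

StrictlyDecreasing : List ℕ → Set
StrictlyDecreasing = Linked _>_

-- Each factor αₖ ends at the greatest descent top xₖ of the word w that remains. The letter after
-- xₖ is smaller, and the descent tops of the rest of w are at most xₖ and distinct from it, so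
-- x₁ > x₂ > ⋯ > xᵢ > β₁.
-- A word following such an x (all its descent tops at most x) splits as low · high with
-- low < x < high and high increasing. Each letter of high is in turn the last and greatest letter,
-- so rix (u · x · low · high) = rix (u · x · low) + |high|, and rix (u · x · low) = rix low when u
-- and low are nonempty, x being the greatest letter. Hence dropping αₖ leaves rix unchanged and
-- rix σ = rix β. The word β = a · low · high has the same shape, so rix β = [low = ε] + |high|:
-- this counts the letters ≥ a in the increasing suffix of β, and vanishes exactly when β is an
-- F-hook.

module Submission where

open import Defs
open import Data.Nat using (ℕ; zero; suc; _+_; _≤_; _<_; _>_; _<ᵇ_; _≡ᵇ_; _≤ᵇ_; z≤n; s≤s)
open import Data.Nat.Properties
  using ( ≤-refl; ≤-trans; ≤-antisym; <-trans; ≤-<-trans; <-asym; <-cmp; <⇒≤; <⇒≢; <⇒≱; ≮⇒≥; ≤∧≢⇒<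
        ; n≤1+n; m≤n⇒m≤1+n; +-suc; +-identityʳ; m+1+n≢0; ⊔-sel; ⊔-lub; m≤m⊔n; m≤n⊔m; ⊔-identityʳ
        ; suc-injective; ≡ᵇ⇒≡; ≡⇒≡ᵇ; <ᵇ-reflects-<; ≤⇒≤ᵇ; ≤ᵇ⇒≤ )
open import Data.Bool using (true; false)
open import Data.Empty using (⊥-elim)
open import Data.Product using (_×_; _,_; proj₁; proj₂; uncurry; ∃-syntax)
open import Data.Sum using (inj₁; inj₂)
open import Data.List using (List; []; _∷_; _++_; length; reverse; filterᵇ; map; upTo)
open import Data.List.Properties
  using ( ++-assoc; ++-identityʳ; length-++; length-++-≤ˡ; length-++-≤ʳ; length-++-sucʳ
        ; length-map; length-upTo; ʳ++-defn; reverse-++; reverse-involutive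
        ; filter-++; filter-all; filter-none; filter-accept )
open import Data.List.Membership.Propositional using (_∈_)
open import Data.List.Relation.Unary.All as All using (All; []; _∷_)
open import Data.List.Relation.Unary.All.Properties using (++⁺; ++⁻ʳ)
open import Data.List.Relation.Unary.Any using (here; there)
import Data.List.Relation.Unary.Any.Properties as Any
open import Data.List.Relation.Unary.AllPairs as AllPairs using ([]; _∷_)
open import Data.List.Relation.Unary.Linked as Linked using (Linked; []; [-]; _∷_)
open import Data.List.Relation.Unary.Linked.Properties using (Linked⇒AllPairs)
open import Data.List.Relation.Unary.Unique.Propositional using (Unique)
import Data.List.Relation.Unary.Unique.Propositional.Properties as Unique
open import Data.List.Relation.Binary.Permutation.Propositional using (↭-sym; ↭⇒↭ₛ)
open import Data.List.Relation.Binary.Permutation.Propositional.Properties using (↭-length)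
import Data.List.Relation.Binary.Permutation.Setoid.Properties as PermutationSetoid
open import Function using (_∘_)
open import Function.Bundles using (_⇔_; mk⇔)
open import Relation.Binary.PropositionalEquality
  using (_≡_; _≢_; refl; sym; trans; cong; subst; ≢-sym; setoid; module ≡-Reasoning)
open import Relation.Binary.Definitions using (tri<; tri≈; tri>)
open import Relation.Nullary.Decidable using (T?)
open import Relation.Nullary.Reflects using (Reflects; ofʸ; ofⁿ; fromEquivalence)

open ≡-Reasoning

maxList-ub : ∀ w → All (_≤ maxList w) w
maxList-ub []      = []
maxList-ub (a ∷ w) =
  m≤m⊔n a (maxList w) ∷ All.map (λ b≤ → ≤-trans b≤ (m≤n⊔m a (maxList w))) (maxList-ub w)

maxList-lub : ∀ {w z} → All (_≤ z) w → maxList w ≤ z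
maxList-lub []       = z≤n
maxList-lub (p ∷ ps) = ⊔-lub p (maxList-lub ps)

maxList-∈ : ∀ a w → maxList (a ∷ w) ∈ a ∷ w
maxList-∈ a []      = here (⊔-identityʳ a)
maxList-∈ a (b ∷ w) with ⊔-sel a (maxList (b ∷ w))
... | inj₁ eq = here eq
... | inj₂ eq = there (subst (_∈ b ∷ w) (sym eq) (maxList-∈ b w))

maxList-++-∷ : ∀ {M} u v → All (_≤ M) u → All (_≤ M) v → maxList (u ++ M ∷ v) ≡ M
maxList-++-∷ u v u≤M v≤M = ≤-antisym
  (maxList-lub (++⁺ u≤M (≤-refl ∷ v≤M)))
  (All.head (++⁻ʳ u (maxList-ub (u ++ _ ∷ v))))

≡ᵇ-reflects-≡ : ∀ m n → Reflects (m ≡ n) (m ≡ᵇ n)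
≡ᵇ-reflects-≡ m n = fromEquivalence (≡ᵇ⇒≡ m n) (≡⇒≡ᵇ m n)

splitOn-++ : ∀ {x} u v → All (_≢ x) u → splitOn x (u ++ x ∷ v) ≡ (u , v)
splitOn-++ {x} [] v [] with x ≡ᵇ x | ≡ᵇ-reflects-≡ x x
... | true  | _       = refl
... | false | ofⁿ x≢x = ⊥-elim (x≢x refl)
splitOn-++ {x} (a ∷ u) v (a≢x ∷ u≢x) with a ≡ᵇ x | ≡ᵇ-reflects-≡ a x
... | true  | ofʸ a≡x = ⊥-elim (a≢x a≡x)
... | false | _       rewrite splitOn-++ u v u≢x = refl

splitOn-shorter : ∀ {x} w → x ∈ w →
  length (proj₁ (splitOn x w)) < length w × length (proj₂ (splitOn x w)) < length w
splitOn-shorter {x} (a ∷ w) x∈ with a ≡ᵇ x | ≡ᵇ-reflects-≡ a x | x∈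
... | true  | _       | _          = s≤s z≤n , ≤-refl
... | false | ofⁿ a≢x | here x≡a   = ⊥-elim (a≢x (sym x≡a))
... | false | _       | there x∈w  =
  let (pre , post) = splitOn-shorter w x∈w in s≤s pre , m≤n⇒m≤1+n post

rixStep : ℕ → List ℕ × List ℕ → ℕ
rixStep f ([] , [])           = 1 + rixAux f []
rixStep f ([] , _ ∷ _)        = 0
rixStep f (p ∷ pre , [])      = 1 + rixAux f (p ∷ pre)
rixStep f (_ ∷ _ , c ∷ post)  = rixAux f (c ∷ post)

rixAux-unfold : ∀ f a w → rixAux (suc f) (a ∷ w) ≡ rixStep f (splitOn (maxList (a ∷ w)) (a ∷ w))
rixAux-unfold f a w with splitOn (maxList (a ∷ w)) (a ∷ w)
... | [] , []         = refl
... | [] , _ ∷ _      = refl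
... | _ ∷ _ , []      = refl
... | _ ∷ _ , _ ∷ _   = refl

rixAux-[] : ∀ f → rixAux f [] ≡ 0
rixAux-[] zero    = refl
rixAux-[] (suc f) = refl

rixAux-fuel : ∀ f g w → length w ≤ f → length w ≤ g → rixAux f w ≡ rixAux g w
rixAux-fuel f g [] _ _ = trans (rixAux-[] f) (sym (rixAux-[] g))
rixAux-fuel (suc f) (suc g) (a ∷ w) (s≤s w≤f) (s≤s w≤g) = begin
  rixAux (suc f) (a ∷ w)  ≡⟨ rixAux-unfold f a w ⟩
  rixStep f s             ≡⟨ step s (splitOn-shorter (a ∷ w) (maxList-∈ a w)) ⟩
  rixStep g s             ≡⟨ sym (rixAux-unfold g a w) ⟩
  rixAux (suc g) (a ∷ w)  ∎
  where
  s = splitOn (maxList (a ∷ w)) (a ∷ w)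
  step : ∀ s → length (proj₁ s) < suc (length w) × length (proj₂ s) < suc (length w) →
         rixStep f s ≡ rixStep g s
  step ([] , [])                _                = cong suc (rixAux-fuel f g [] z≤n z≤n)
  step ([] , _ ∷ _)             _                = refl
  step (p ∷ pre , [])           (s≤s pre≤w , _)  =
    cong suc (rixAux-fuel f g (p ∷ pre) (≤-trans pre≤w w≤f) (≤-trans pre≤w w≤g))
  step (_ ∷ _ , c ∷ post)       (_ , s≤s post≤w) =
    rixAux-fuel f g (c ∷ post) (≤-trans post≤w w≤f) (≤-trans post≤w w≤g)

rixAtMax : List ℕ → List ℕ → ℕ
rixAtMax []      []      = 1
rixAtMax []      (_ ∷ _) = 0
rixAtMax (p ∷ u) []      = suc (rix (p ∷ u))
rixAtMax (_ ∷ _) (c ∷ v) = rix (c ∷ v)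

rixStep≡rixAtMax : ∀ f u v → length u ≤ f → length v ≤ f → rixStep f (u , v) ≡ rixAtMax u v
rixStep≡rixAtMax f []      []      _   _   = cong suc (rixAux-[] f)
rixStep≡rixAtMax f []      (_ ∷ _) _   _   = refl
rixStep≡rixAtMax f (p ∷ u) []      u≤f _   = cong suc (rixAux-fuel f _ (p ∷ u) u≤f ≤-refl)
rixStep≡rixAtMax f (_ ∷ _) (c ∷ v) _   v≤f = rixAux-fuel f _ (c ∷ v) v≤f ≤-refl

rix-max : ∀ u M v → All (_< M) u → All (_≤ M) v → rix (u ++ M ∷ v) ≡ rixAtMax u v
rix-max [] M v _ v≤M = begin
  rix (M ∷ v)                                            ≡⟨ rixAux-unfold (length v) M v ⟩
  rixStep (length v) (splitOn (maxList (M ∷ v)) (M ∷ v)) ≡⟨ cong (λ m → rixStep _ (splitOn m (M ∷ v)))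
                                                                 (maxList-++-∷ [] v [] v≤M) ⟩
  rixStep (length v) (splitOn M (M ∷ v))                 ≡⟨ cong (rixStep _) (splitOn-++ {M} [] v []) ⟩
  rixStep (length v) ([] , v)                            ≡⟨ rixStep≡rixAtMax _ [] v z≤n ≤-refl ⟩
  rixAtMax [] v                                          ∎
rix-max (p ∷ u) M v pu<M v≤M = begin
  rix w                              ≡⟨ rixAux-unfold K p (u ++ M ∷ v) ⟩
  rixStep K (splitOn (maxList w) w)  ≡⟨ cong (λ m → rixStep K (splitOn m w))
                                             (maxList-++-∷ (p ∷ u) v (All.map <⇒≤ pu<M) v≤M) ⟩
  rixStep K (splitOn M w)            ≡⟨ cong (rixStep K) (splitOn-++ (p ∷ u) v (All.map <⇒≢ pu<M)) ⟩
  rixStep K (p ∷ u , v)              ≡⟨ rixStep≡rixAtMax K (p ∷ u) v pu≤K v≤K ⟩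
  rixAtMax (p ∷ u) v                 ∎
  where
  w = p ∷ u ++ M ∷ v
  K = length (u ++ M ∷ v)
  pu≤K : suc (length u) ≤ K
  pu≤K = subst (suc (length u) ≤_) (sym (length-++-sucʳ u M v)) (s≤s (length-++-≤ˡ u))
  v≤K : length v ≤ K
  v≤K = ≤-trans (n≤1+n _) (length-++-≤ʳ (M ∷ v) {u})

rix-∷ʳ-max : ∀ {M} u → All (_< M) u → rix (u ++ M ∷ []) ≡ suc (rix u)
rix-∷ʳ-max {M} []      _    = rix-max [] M [] [] []
rix-∷ʳ-max {M} (p ∷ u) pu<M = rix-max (p ∷ u) M [] pu<M []

rix-++-increasing : ∀ {x} u G → All (_≤ x) u → All (x <_) G → Linked _<_ G →
                    rix (u ++ G) ≡ rix u + length G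
rix-++-increasing u [] _ _ _ = trans (cong rix (++-identityʳ u)) (sym (+-identityʳ _))
rix-++-increasing u (g ∷ G) u≤x (x<g ∷ _) g∷G↑ = begin
  rix (u ++ g ∷ G)              ≡⟨ cong rix (sym (++-assoc u (g ∷ []) G)) ⟩
  rix ((u ++ g ∷ []) ++ G)      ≡⟨ rix-++-increasing (u ++ g ∷ []) G (++⁺ (All.map <⇒≤ u<g) (≤-refl ∷ []))
                                     (AllPairs.head (Linked⇒AllPairs <-trans g∷G↑)) (Linked.tail g∷G↑) ⟩
  rix (u ++ g ∷ []) + length G  ≡⟨ cong (_+ length G) (rix-∷ʳ-max u u<g) ⟩
  suc (rix u) + length G        ≡⟨ sym (+-suc (rix u) (length G)) ⟩
  rix u + length (g ∷ G)        ∎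
  where
  u<g = All.map (λ q≤x → ≤-<-trans q≤x x<g) u≤x

descentTops-tail : ∀ {P : ℕ → Set} a w → All P (descentTops (a ∷ w)) → All P (descentTops w)
descentTops-tail a []      _    = []
descentTops-tail a (b ∷ w) tops with b <ᵇ a
... | true  = All.tail tops
... | false = tops

descentTops-suffix : ∀ {P : ℕ → Set} u v → All P (descentTops (u ++ v)) → All P (descentTops v)
descentTops-suffix []      v tops = tops
descentTops-suffix (a ∷ u) v tops = descentTops-suffix u v (descentTops-tail a (u ++ v) tops)

descentTops-All : ∀ {P : ℕ → Set} {w} → All P w → All P (descentTops w)
descentTops-All {w = []}        _              = []
descentTops-All {w = a ∷ []}    _              = []
descentTops-All {w = a ∷ b ∷ w} (pa ∷ pbw) with b <ᵇ a
... | true  = pa ∷ descentTops-All pbw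
... | false = descentTops-All pbw

ascent-above-descentTops : ∀ {x a b} w → x < a → All (_≤ x) (descentTops (a ∷ b ∷ w)) → a ≤ b
ascent-above-descentTops {a = a} {b} _ x<a tops with b <ᵇ a | <ᵇ-reflects-< b a
... | true  | ofʸ b<a = ⊥-elim (<⇒≱ x<a (All.head tops))
... | false | ofⁿ b≮a = ≮⇒≥ b≮a

record DescentAt (y : ℕ) (w : List ℕ) : Set where
  constructor descentAt
  field
    before : List ℕ
    next   : ℕ
    after  : List ℕ
    splits : w ≡ before ++ y ∷ next ∷ after
    next<y : next < y

∷-DescentAt : ∀ {y} a {w} → DescentAt y w → DescentAt y (a ∷ w)
∷-DescentAt a (descentAt u c t eq c<y) = descentAt (a ∷ u) c t (cong (a ∷_) eq) c<y

∈-descentTops-∷⁻ : ∀ {y} a b w → (y ∈ descentTops (b ∷ w) → DescentAt y (b ∷ w)) →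
                   y ∈ descentTops (a ∷ b ∷ w) → DescentAt y (a ∷ b ∷ w)
∈-descentTops-∷⁻ a b w ih y∈ with b <ᵇ a | <ᵇ-reflects-< b a
... | false | _       = ∷-DescentAt a (ih y∈)
... | true  | ofʸ b<a with y∈
...   | here refl = descentAt [] b w refl b<a
...   | there y∈′ = ∷-DescentAt a (ih y∈′)

∈-descentTops⁻ : ∀ {y} w → y ∈ descentTops w → DescentAt y w
∈-descentTops⁻ (a ∷ b ∷ w) = ∈-descentTops-∷⁻ a b w (∈-descentTops⁻ (b ∷ w))

prefix-below : ∀ {x} u v → All (_≤ x) (descentTops (u ++ x ∷ v)) → All (_≢ x) u → All (_< x) u
prefix-below []          v _    _          = []
prefix-below (p ∷ [])    v tops (p≢x ∷ []) =
  ≤∧≢⇒< (≮⇒≥ λ x<p → <⇒≱ x<p (ascent-above-descentTops v x<p tops)) p≢x ∷ []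
prefix-below {x} (p ∷ q ∷ u) v tops (p≢x ∷ qu≢x)
  with prefix-below (q ∷ u) v (descentTops-tail p (q ∷ u ++ x ∷ v) tops) qu≢x
... | q<x ∷ u<x =
  ≤∧≢⇒< (≮⇒≥ λ x<p → <⇒≱ (<-trans q<x x<p) (ascent-above-descentTops (u ++ x ∷ v) x<p tops)) p≢x
    ∷ q<x ∷ u<x

Unique-suffix : ∀ (u : List ℕ) {v} → Unique (u ++ v) → Unique v
Unique-suffix []      uv       = uv
Unique-suffix (_ ∷ u) (_ ∷ uv) = Unique-suffix u uv

Unique-∉-prefix : ∀ (u : List ℕ) {x v} → Unique (u ++ x ∷ v) → All (_≢ x) u
Unique-∉-prefix []      _          = []
Unique-∉-prefix (a ∷ u) (a∉ ∷ uxv) = All.head (++⁻ʳ u a∉) ∷ Unique-∉-prefix u uxv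

greatestDescentTop : ∀ w {d ds} → descentTops w ≡ d ∷ ds →
  maxList (d ∷ ds) ∈ descentTops w × All (_≤ maxList (d ∷ ds)) (descentTops w)
greatestDescentTop _ {d} {ds} tops≡ =
    subst (maxList (d ∷ ds) ∈_) (sym tops≡) (maxList-∈ d ds)
  , subst (All _) (sym tops≡) (maxList-ub (d ∷ ds))

splitOn-greatestDescentTop : ∀ {x w u v} → Unique w → x ∈ descentTops w → All (_≤ x) (descentTops w) →
  splitOn x w ≡ (u , v) → ∃[ c ] ∃[ t ] (v ≡ c ∷ t × c < x × w ≡ u ++ x ∷ c ∷ t × All (_< x) u)
splitOn-greatestDescentTop {w = w} uw x∈ tops split≡ with ∈-descentTops⁻ w x∈
... | descentAt u₀ c t refl c<x with trans (sym (splitOn-++ u₀ (c ∷ t) (Unique-∉-prefix u₀ uw))) split≡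
...   | refl = c , t , refl , c<x , refl , prefix-below u₀ (c ∷ t) tops (Unique-∉-prefix u₀ uw)

record Cut (x : ℕ) (v : List ℕ) : Set where
  constructor mkCut
  field
    low        : List ℕ
    high       : List ℕ
    splits     : v ≡ low ++ high
    low<x      : All (_< x) low
    x<high     : All (x <_) high
    increasing : Linked _<_ high

∷-Cut-above : ∀ {x a v} → x < a → All (a ≢_) v → All (_≤ x) (descentTops (a ∷ v)) →
              Cut x v → Cut x (a ∷ v)
∷-Cut-above {a = a} x<a _ _ (mkCut [] [] refl _ _ _) = mkCut [] (a ∷ []) refl [] (x<a ∷ []) [-]
∷-Cut-above {a = a} x<a (a≢h ∷ _) tops (mkCut [] (h ∷ hs) refl _ x<high high↑) =
  mkCut [] (a ∷ h ∷ hs) refl [] (x<a ∷ x<high) (≤∧≢⇒< (ascent-above-descentTops hs x<a tops) a≢h ∷ high↑)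
∷-Cut-above x<a _ tops (mkCut (l ∷ low) high refl (l<x ∷ _) _ _) =
  ⊥-elim (<⇒≱ (<-trans l<x x<a) (ascent-above-descentTops (low ++ high) x<a tops))

cut : ∀ x v → Unique (x ∷ v) → All (_≤ x) (descentTops v) → Cut x v
cut x []      _                             _    = mkCut [] [] refl [] [] []
cut x (a ∷ v) ((x≢a ∷ x∉v) ∷ a∉v ∷ uv) tops with <-cmp a x | cut x v (x∉v ∷ uv) (descentTops-tail a v tops)
... | tri< a<x _ _ | mkCut low high refl low<x x<high high↑ =
  mkCut (a ∷ low) high refl (a<x ∷ low<x) x<high high↑
... | tri≈ _ a≡x _ | _  = ⊥-elim (x≢a (sym a≡x))
... | tri> _ _ x<a | cv = ∷-Cut-above x<a a∉v tops cv

rix-cut : ∀ {x v} u → All (_< x) u → (c : Cut x v) →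
          rix (u ++ x ∷ v) ≡ rixAtMax u (Cut.low c) + length (Cut.high c)
rix-cut {x} u u<x (mkCut low high refl low<x x<high high↑) = begin
  rix (u ++ x ∷ low ++ high)    ≡⟨ cong rix (sym (++-assoc u (x ∷ low) high)) ⟩
  rix ((u ++ x ∷ low) ++ high)  ≡⟨ rix-++-increasing (u ++ x ∷ low) high
                                     (++⁺ (All.map <⇒≤ u<x) (≤-refl ∷ All.map <⇒≤ low<x)) x<high high↑ ⟩
  rix (u ++ x ∷ low) + length high  ≡⟨ cong (_+ length high) (rix-max u x low u<x (All.map <⇒≤ low<x)) ⟩
  rixAtMax u low + length high  ∎

rix-after-hook : ∀ {x c t} p u → All (_< x) (p ∷ u) → c < x → Cut x (c ∷ t) →
                 rix ((p ∷ u) ++ x ∷ c ∷ t) ≡ rix (c ∷ t)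
rix-after-hook p u _ c<x (mkCut [] high refl _ x<high _) = ⊥-elim (<-asym c<x (All.head x<high))
rix-after-hook {x} {c} {t} p u pu<x c<x ct@(mkCut (l ∷ low) high splits low<x x<high high↑) = begin
  rix ((p ∷ u) ++ x ∷ c ∷ t)    ≡⟨ rix-cut (p ∷ u) pu<x ct ⟩
  rix (l ∷ low) + length high   ≡⟨ sym (rix-++-increasing (l ∷ low) high (All.map <⇒≤ low<x) x<high high↑) ⟩
  rix ((l ∷ low) ++ high)       ≡⟨ cong rix (sym splits) ⟩
  rix (c ∷ t)                   ∎

decPrefix-∷ : ∀ {g} Q → All (_< g) Q → decPrefix (g ∷ Q) ≡ g ∷ decPrefix Q
decPrefix-∷ []      _           = refl
decPrefix-∷ {g} (q ∷ _) (q<g ∷ _) with q <ᵇ g | <ᵇ-reflects-< q g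
... | true  | _       = refl
... | false | ofⁿ q≮g = ⊥-elim (q≮g q<g)

decPrefix-∷-cong : ∀ r b X Y → decPrefix (b ∷ X) ≡ decPrefix (b ∷ Y) →
                   decPrefix (r ∷ b ∷ X) ≡ decPrefix (r ∷ b ∷ Y)
decPrefix-∷-cong r b _ _ eq with b <ᵇ r
... | true  = cong (r ∷_) eq
... | false = refl

decPrefix-ascent : ∀ {c a} m → c < a → decPrefix (m ++ c ∷ a ∷ []) ≡ decPrefix (m ++ c ∷ [])
decPrefix-ascent {c} {a} [] c<a with a <ᵇ c | <ᵇ-reflects-< a c
... | true  | ofʸ a<c = ⊥-elim (<-asym c<a a<c)
... | false | _       = refl
decPrefix-ascent {c} {a} (r ∷ []) c<a = decPrefix-∷-cong r c (a ∷ []) [] (decPrefix-ascent [] c<a)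
decPrefix-ascent {c} {a} (r ∷ b ∷ m) c<a =
  decPrefix-∷-cong r b (m ++ c ∷ a ∷ []) (m ++ c ∷ []) (decPrefix-ascent (b ∷ m) c<a)

decPrefix-All : ∀ {P : ℕ → Set} {w} → All P w → All P (decPrefix w)
decPrefix-All {w = []}        []           = []
decPrefix-All {w = a ∷ []}    (pa ∷ [])    = pa ∷ []
decPrefix-All {w = a ∷ b ∷ w} (pa ∷ pbw) with b <ᵇ a
... | true  = pa ∷ decPrefix-All pbw
... | false = pa ∷ []

reverse-∷-++ : ∀ (g : ℕ) G Q → reverse (g ∷ G) ++ Q ≡ reverse G ++ g ∷ Q
reverse-∷-++ g G Q = trans (sym (ʳ++-defn (g ∷ G))) (ʳ++-defn G)

All-reverse : ∀ {P : ℕ → Set} {w} → All P w → All P (reverse w)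
All-reverse pw = All.tabulate (All.lookup pw ∘ Any.reverse⁻)

decPrefix-reverse-++ : ∀ {x} G Q → All (x <_) G → Linked _<_ G → All (_≤ x) Q →
                       decPrefix (reverse G ++ Q) ≡ reverse G ++ decPrefix Q
decPrefix-reverse-++ []      Q _         _    _   = refl
decPrefix-reverse-++ (g ∷ G) Q (x<g ∷ _) g∷G↑ Q≤x = begin
  decPrefix (reverse (g ∷ G) ++ Q)  ≡⟨ cong decPrefix (reverse-∷-++ g G Q) ⟩
  decPrefix (reverse G ++ g ∷ Q)    ≡⟨ decPrefix-reverse-++ G (g ∷ Q) g<G (Linked.tail g∷G↑)
                                                             (≤-refl ∷ All.map <⇒≤ Q<g) ⟩
  reverse G ++ decPrefix (g ∷ Q)    ≡⟨ cong (reverse G ++_) (decPrefix-∷ Q Q<g) ⟩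
  reverse G ++ g ∷ decPrefix Q      ≡⟨ sym (reverse-∷-++ g G (decPrefix Q)) ⟩
  reverse (g ∷ G) ++ decPrefix Q    ∎
  where
  g<G = AllPairs.head (Linked⇒AllPairs <-trans g∷G↑)
  Q<g = All.map (λ q≤x → ≤-<-trans q≤x x<g) Q≤x

incSuffix-++ : ∀ {x} u G → All (_≤ x) u → All (x <_) G → Linked _<_ G →
               incSuffix (u ++ G) ≡ incSuffix u ++ G
incSuffix-++ u G u≤x x<G G↑ = begin
  reverse (decPrefix (reverse (u ++ G)))        ≡⟨ cong (reverse ∘ decPrefix) (reverse-++ u G) ⟩
  reverse (decPrefix (reverse G ++ reverse u))  ≡⟨ cong reverse (decPrefix-reverse-++ G (reverse u) x<G G↑
                                                                                       (All-reverse u≤x)) ⟩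
  reverse (reverse G ++ decPrefix (reverse u))  ≡⟨ reverse-++ (reverse G) (decPrefix (reverse u)) ⟩
  incSuffix u ++ reverse (reverse G)            ≡⟨ cong (incSuffix u ++_) (reverse-involutive G) ⟩
  incSuffix u ++ G                              ∎

incSuffix-∷-> : ∀ {a c} l → c < a → incSuffix (a ∷ c ∷ l) ≡ incSuffix (c ∷ l)
incSuffix-∷-> {a} {c} l c<a = cong reverse (begin
  decPrefix (reverse (a ∷ c ∷ l))      ≡⟨ cong decPrefix (ʳ++-defn l) ⟩
  decPrefix (reverse l ++ c ∷ a ∷ [])  ≡⟨ decPrefix-ascent (reverse l) c<a ⟩
  decPrefix (reverse l ++ c ∷ [])      ≡⟨ cong decPrefix (sym (ʳ++-defn l)) ⟩
  decPrefix (reverse (c ∷ l))          ∎)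

incSuffix-All : ∀ {P : ℕ → Set} {w} → All P w → All P (incSuffix w)
incSuffix-All = All-reverse ∘ decPrefix-All ∘ All-reverse

length-filter-incSuffix : ∀ {a t} (c : Cut a t) →
  length (filterᵇ (a ≤ᵇ_) (incSuffix (a ∷ t))) ≡ rixAtMax [] (Cut.low c) + length (Cut.high c)
length-filter-incSuffix {a} (mkCut low high refl low<a a<high high↑) = begin
  length (filterᵇ (a ≤ᵇ_) (incSuffix (a ∷ low ++ high)))
    ≡⟨ cong (length ∘ filterᵇ (a ≤ᵇ_)) (incSuffix-++ (a ∷ low) high a∷low≤a a<high high↑) ⟩
  length (filterᵇ (a ≤ᵇ_) (incSuffix (a ∷ low) ++ high))
    ≡⟨ cong length (filter-++ P? (incSuffix (a ∷ low)) high) ⟩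
  length (filterᵇ (a ≤ᵇ_) (incSuffix (a ∷ low)) ++ filterᵇ (a ≤ᵇ_) high)
    ≡⟨ cong (λ h → length (filterᵇ (a ≤ᵇ_) (incSuffix (a ∷ low)) ++ h)) (filter-all P? a≤ᵇhigh) ⟩
  length (filterᵇ (a ≤ᵇ_) (incSuffix (a ∷ low)) ++ high)
    ≡⟨ length-++ (filterᵇ (a ≤ᵇ_) (incSuffix (a ∷ low))) ⟩
  length (filterᵇ (a ≤ᵇ_) (incSuffix (a ∷ low))) + length high
    ≡⟨ cong (_+ length high) (count-top low low<a) ⟩
  rixAtMax [] low + length high  ∎
  where
  P? = T? ∘ (a ≤ᵇ_)
  a∷low≤a = ≤-refl ∷ All.map <⇒≤ low<a
  a≤ᵇhigh = All.map (≤⇒≤ᵇ ∘ <⇒≤) a<high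
  count-top : ∀ low → All (_< a) low → length (filterᵇ (a ≤ᵇ_) (incSuffix (a ∷ low))) ≡ rixAtMax [] low
  count-top []      _     = cong length (filter-accept P? (≤⇒≤ᵇ (≤-refl {a})))
  count-top (c ∷ l) cl<a  = cong length (trans (cong (filterᵇ (a ≤ᵇ_)) (incSuffix-∷-> l (All.head cl<a)))
    (filter-none P? (All.map (λ q<a → <⇒≱ q<a ∘ ≤ᵇ⇒≤ a _) (incSuffix-All cl<a))))

-- a ∷ low ++ high as in Cut a: an F-hook when high is empty and low is not, an L-hook otherwise.
data Hook : List ℕ → Set where
  hook : ∀ {a t} → Cut a t → Hook (a ∷ t)

IsFHook⇒bounded : ∀ {a t} → IsFHook (a ∷ t) → All (_≤ a) t
IsFHook⇒bounded (_ , _ , _ , refl , t≤a) = t≤a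

Cut-≡0⇔IsFHook : ∀ {a t} (c : Cut a t) →
                 (rixAtMax [] (Cut.low c) + length (Cut.high c) ≡ 0) ⇔ IsFHook (a ∷ t)
Cut-≡0⇔IsFHook (mkCut [] [] refl _ _ _) = mk⇔ (λ ()) (λ { (_ , _ , _ , () , _) })
Cut-≡0⇔IsFHook {a} (mkCut (l ∷ low) [] refl low<a _ _) =
  mk⇔ (λ _ → a , l , low ++ [] , refl , ++⁺ (All.map <⇒≤ low<a) []) (λ _ → refl)
Cut-≡0⇔IsFHook (mkCut low (h ∷ _) refl _ (a<h ∷ _) _) =
  mk⇔ (λ rix≡0 → ⊥-elim (m+1+n≢0 (rixAtMax [] low) rix≡0))
      (λ fhook → ⊥-elim (<⇒≱ a<h (All.head (++⁻ʳ low (IsFHook⇒bounded fhook)))))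

Hook-rix≡0⇔IsFHook : ∀ {β} → Hook β → (rix β ≡ 0) ⇔ IsFHook β
Hook-rix≡0⇔IsFHook {β} (hook c) = subst (λ k → (k ≡ 0) ⇔ IsFHook β) (sym (rix-cut [] [] c)) (Cut-≡0⇔IsFHook c)

Hook-rix≡count : ∀ {β} → Hook β → rix β ≡ length (filterᵇ (firstLetter β ≤ᵇ_) (incSuffix β))
Hook-rix≡count (hook c) = trans (rix-cut [] [] c) (sym (length-filter-incSuffix c))

lastLetter-∷ʳ : ∀ p u (x : ℕ) → lastLetter ((p ∷ u) ++ x ∷ []) ≡ x
lastLetter-∷ʳ p []      x = refl
lastLetter-∷ʳ p (q ∷ u) x = lastLetter-∷ʳ q u x

lastLetters : List (List ℕ) × List ℕ → List ℕ
lastLetters r = map lastLetter (proj₁ r) ++ firstLetter (proj₂ r) ∷ []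

record FactorizationInvariant (w : List ℕ) (r : List (List ℕ) × List ℕ) : Set where
  field
    -- z stands for the last letter of a preceding factor.
    lastLetters-decreasing : ∀ z → All (_< z) (firstLetter w ∷ descentTops w) →
                             Linked _>_ (z ∷ lastLetters r)
    rix-final              : rix w ≡ rix (proj₂ r)
    final-hook             : Hook (proj₂ r)

FactorizationInvariant-stop : ∀ {a t} → Unique (a ∷ t) → All (_≤ a) (descentTops t) →
                              FactorizationInvariant (a ∷ t) ([] , a ∷ t)
FactorizationInvariant-stop {a} {t} ua tops≤a = record
  { lastLetters-decreasing = λ { z (a<z ∷ _) → a<z ∷ [-] }
  ; rix-final              = refl
  ; final-hook             = hook (cut a t ua tops≤a)
  }

FactorizationInvariant-∷ : ∀ {p u x c t r} → let w = (p ∷ u) ++ x ∷ c ∷ t in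
  Unique w → x ∈ descentTops w → All (_≤ x) (descentTops w) → All (_< x) (p ∷ u) → c < x →
  FactorizationInvariant (c ∷ t) r → FactorizationInvariant w (((p ∷ u) ++ x ∷ []) ∷ proj₁ r , proj₂ r)
FactorizationInvariant-∷ {p} {u} {x} {c} {t} {r} uw x∈ tops pu<x c<x inv = record
  { lastLetters-decreasing = λ z w<z →
      subst (λ y → Linked _>_ (z ∷ y ∷ lastLetters r)) (sym (lastLetter-∷ʳ p u x))
            (All.lookup (All.tail w<z) x∈ ∷ lastLetters-decreasing x (c<x ∷ ct-tops<x))
  ; rix-final  = trans (rix-after-hook p u pu<x c<x (cut x (c ∷ t) uxct ct-tops≤x)) rix-final
  ; final-hook = final-hook
  }
  where
  open FactorizationInvariant inv
  uxct : Unique (x ∷ c ∷ t)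
  uxct = Unique-suffix (p ∷ u) uw
  ct-tops≤x : All (_≤ x) (descentTops (c ∷ t))
  ct-tops≤x = descentTops-tail x (c ∷ t) (descentTops-suffix (p ∷ u) (x ∷ c ∷ t) tops)
  ct-tops<x : All (_< x) (descentTops (c ∷ t))
  ct-tops<x = All.zipWith (uncurry ≤∧≢⇒<) (ct-tops≤x , descentTops-All (All.map ≢-sym (AllPairs.head uxct)))

rixFactAux-invariant : ∀ f a t → Unique (a ∷ t) → length t < f →
                       FactorizationInvariant (a ∷ t) (rixFactAux f (a ∷ t))
rixFactAux-invariant (suc f) a t ua (s≤s t≤f) with descentTops (a ∷ t) in tops≡
... | [] = FactorizationInvariant-stop ua (descentTops-tail a t (subst (All (_≤ a)) (sym tops≡) []))
... | d ∷ ds with greatestDescentTop (a ∷ t) tops≡ | splitOn (maxList (d ∷ ds)) (a ∷ t) in split≡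
...   | x∈ , tops≤x | [] , v with splitOn-greatestDescentTop {w = a ∷ t} ua x∈ tops≤x split≡
...     | _ , _ , refl , _ , refl , _ = FactorizationInvariant-stop ua (descentTops-tail a t tops≤x)
rixFactAux-invariant (suc f) a t ua (s≤s t≤f) | d ∷ ds | x∈ , tops≤x | p ∷ u , v
  with splitOn-greatestDescentTop {w = a ∷ t} ua x∈ tops≤x split≡
... | c , t′ , refl , c<x , refl , pu<x =
  FactorizationInvariant-∷ ua x∈ tops≤x pu<x c<x (rixFactAux-invariant f c t′ uct′ t′<f)
  where
  uct′ = AllPairs.tail (Unique-suffix (p ∷ u) ua)
  t′<f : length t′ < f
  t′<f = ≤-trans (n≤1+n _) (≤-trans (length-++-≤ʳ (maxList (d ∷ ds) ∷ c ∷ t′) {u}) t≤f)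

IsPerm-length : ∀ {n σ} → IsPerm n σ → length σ ≡ n
IsPerm-length {n} σ↭ = trans (↭-length σ↭) (trans (length-map suc (upTo n)) (length-upTo n))

IsPerm-Unique : ∀ {n σ} → IsPerm n σ → Unique σ
IsPerm-Unique {n} σ↭ =
  PermutationSetoid.Unique-resp-↭ (setoid ℕ) (↭⇒↭ₛ (↭-sym σ↭)) (Unique.map⁺ suc-injective (Unique.upTo⁺ n))

proposition3p2 : (n : ℕ) → 1 ≤ n → (σ : List ℕ) → IsPerm n σ →
    StrictlyDecreasing (map lastLetter (proj₁ (rixFact σ)) ++ (beta1 σ ∷ []))
    × ((rix σ ≡ 0) ⇔ IsFHook (proj₂ (rixFact σ)))
    × (rix σ ≡ length (RIX σ))
proposition3p2 n 1≤n [] σ↭ = ⊥-elim (<⇒≢ 1≤n (IsPerm-length σ↭))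
proposition3p2 n _ (a ∷ t) σ↭ =
    Linked.tail (lastLetters-decreasing _ (All.map s≤s (maxList-ub (a ∷ descentTops (a ∷ t)))))
  , subst (λ k → (k ≡ 0) ⇔ IsFHook β) (sym rix-final) (Hook-rix≡0⇔IsFHook final-hook)
  , trans rix-final (Hook-rix≡count final-hook)
  where
  open FactorizationInvariant (rixFactAux-invariant (suc (length t)) a t (IsPerm-Unique σ↭) ≤-refl)
  β = proj₂ (rixFact (a ∷ t))
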